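{- Let $k,n\in\mathbb{N}$ with $4\le k\le n-2$. Let $\mathcal{H}$ be a hierarchy on $[n]$ all of whose clusters have cardinality between $2$ and $n-k$. Let $a,a'\in[n]$ and $J\in\mathcal{H}$ with $a\in J$, $a'\notin J$. When $a'\in\bigcup_{H\in\mathcal{H}}H$, let $M_{a'}$ and $m_{a'}$ be the maximal and the minimal $\mathcal{H}$-cluster containing $a'$. Let $X,X'\in\binom{[n]\setminus\{a,a'\}}{k-1}$ satisfy: 1. if $a'\in\bigcup_H H$, then (1.1) $X$ and $X'$ both contain an element $b\in m_{a'}$ with $b\ne a'$, and (1.2) $X$ contains an element $c\notin M_{a'}$ and $X'$ contains an element $c'\notin M_{a'}$; 2. if $a'\notin\bigcup_H H$, then $X$ and $X'$ both contain an element $d$ not in the maximal cluster containing $J$; 3. if there exists $\bar J\in\mathcal{H}$ with $a\in\bar J\subsetneq J$, then, taking $\bar J$ maximal among the $\mathcal{H}$-clusters with these properties, $X'$ contains an element of $J\setminus\bar J$ and $X'\cap\bar J=\emptyset$; if no such $\bar J$ exists, then $X'\cap J\ne\emptyset$; 4. $X\cap J=\emptyset$; moreover, if there exists $\tilde J\in\mathcal{H}$ with $J\subsetneq\tilde J$, then, taking $\tilde J$ minimal among the $\mathcal{H}$-clusters with this property, $X$ contains an element of $\tilde J\setminus J$. Then, in the free $\mathbb{Z}$-module $\bigoplus_{H\in\mathcal{H}}\mathbb{Z}H$, $$J=\sum_{\substack{H\in\mathcal{H},\ H\cap(aX)\ne\emptyset,\\ H\not\supset aX}}H-\sum_{\substack{H\in\mathcal{H},\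 H\cap(a'X)\ne\emptyset,\\ H\not\supset a'X}}H-\sum_{\substack{H\in\mathcal{H},\ H\cap(aX')\ne\emptyset,\\ H\not\supset aX'}}H+\sum_{\substack{H\in\mathcal{H},\ H\cap(a'X')\ne\emptyset,\\ H\not\supset a'X'}}H,$$ where $aX$ denotes $\{a\}\cup X$, etc.
   Context: $[n]=\{1,\dots,n\}$. A hierarchy on a set $S$ is a family $\mathcal{H}$ of subsets of $S$ (called $\mathcal{H}$-clusters) such that for all $H,H'\in\mathcal{H}$, $H\cap H'$ is one of $\emptyset,H,H'$. The free $\mathbb{Z}$-module $\bigoplus_{H\in\mathcal{H}}\mathbb{Z}H$ has the clusters of $\mathcal{H}$ as a basis. -}

module Defs where

open import Data.Nat using (ℕ; _≤_; _∸_; _+_)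
open import Data.Integer as ℤ using (ℤ)
open import Data.Fin using (Fin)
open import Data.Fin.Subset
open import Data.Fin.Subset.Properties using (nonempty?; _⊆?_)
open import Data.List using (List; []; _∷_; foldr; filter)
open import Data.List.Relation.Unary.Unique.Propositional using (Unique)
import Data.List.Membership.Propositional as LM
open import Data.Product using (_×_; ∃; ∃-syntax)
open import Data.Sum using (_⊎_)
open import Relation.Binary.PropositionalEquality using (_≡_)
open import Relation.Nullary using (¬_; Dec; yes; no)
import Data.Bool
open import Data.Vec.Properties using (≡-dec)
open import Relation.Nullary.Decidable using (_×-dec_; ¬?)

private variable n : ℕ

_∈ℋ_ : Subset n → List (Subset n) → Set
H ∈ℋ ℋ = H LM.∈ ℋ

record IsHierarchy {n : ℕ} (ℋ : List (Subset n)) : Set where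
  field
    noDup    : Unique ℋ
    laminar  : ∀ {H H'} → H ∈ℋ ℋ → H' ∈ℋ ℋ →
               (H ∩ H' ≡ ⊥) ⊎ (H ∩ H' ≡ H) ⊎ (H ∩ H' ≡ H')

IsMaxClusterContaining : List (Subset n) → Fin n → Subset n → Set
IsMaxClusterContaining ℋ x M =
  M ∈ℋ ℋ × x ∈ M × (∀ H → H ∈ℋ ℋ → x ∈ H → ¬ (M ⊂ H))

IsMinClusterContaining : List (Subset n) → Fin n → Subset n → Set
IsMinClusterContaining ℋ x m =
  m ∈ℋ ℋ × x ∈ m × (∀ H → H ∈ℋ ℋ → x ∈ H → ¬ (H ⊂ m))

IsMaxClusterAbove : List (Subset n) → Subset n → Subset n → Set
IsMaxClusterAbove ℋ J K =
  K ∈ℋ ℋ × J ⊆ K × (∀ H → H ∈ℋ ℋ → J ⊆ H → ¬ (K ⊂ H))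

IsMaxClusterBelow : List (Subset n) → Fin n → Subset n → Subset n → Set
IsMaxClusterBelow ℋ a J J̄ =
  J̄ ∈ℋ ℋ × a ∈ J̄ × J̄ ⊂ J × (∀ H → H ∈ℋ ℋ → a ∈ H → H ⊂ J → ¬ (J̄ ⊂ H))

IsMinClusterStrictlyAbove : List (Subset n) → Subset n → Subset n → Set
IsMinClusterStrictlyAbove ℋ J J̃ =
  J̃ ∈ℋ ℋ × J ⊂ J̃ × (∀ H → H ∈ℋ ℋ → J ⊂ H → ¬ (H ⊂ J̃))

-- Formal ℤ-linear combinations of subsets of Fin n (coefficient functions).
-- The free ℤ-module ⊕_{H∈ℋ} ℤH is the submodule spanned by the clusters;
-- equality there is coefficientwise equality.
Comb : ℕ → Set
Comb n = Subset n → ℤ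

_≟ˢ_ : (p q : Subset n) → Dec (p ≡ q)
_≟ˢ_ = ≡-dec Data.Bool._≟_

gen : Subset n → Comb n
gen H K with K ≟ˢ H
... | yes _ = ℤ.1ℤ
... | no _  = ℤ.0ℤ

0ᶜ : Comb n
0ᶜ K = ℤ.0ℤ

_+ᶜ_ : Comb n → Comb n → Comb n
(f +ᶜ g) K = f K ℤ.+ g K

_-ᶜ_ : Comb n → Comb n → Comb n
(f -ᶜ g) K = f K ℤ.- g K

infixl 6 _+ᶜ_ _-ᶜ_
infix 4 _≈ᶜ_

_≈ᶜ_ : Comb n → Comb n → Set
f ≈ᶜ g = ∀ K → f K ≡ g K

Σᶜ : List (Subset n) → Comb n
Σᶜ = foldr (λ H acc → gen H +ᶜ acc) 0ᶜ

Crosses : Subset n → Subset n → Set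
Crosses S H = Nonempty (H ∩ S) × ¬ (S ⊆ H)

crosses? : (S H : Subset n) → Dec (Crosses S H)
crosses? S H = nonempty? (H ∩ S) ×-dec ¬? (S ⊆? H)

crossSum : List (Subset n) → Subset n → Comb n
crossSum ℋ S = Σᶜ (filter (crosses? S) ℋ)

-- Writing δ_Y(H) = [H crosses aY] − [H crosses a'Y],
-- the right-hand side at H is δ_X(H) − δ_X'(H). Now δ_Y(H) = 0 if H does not separate a from
-- a', or if Y straddles H (meets it and leaves it), since then whether H crosses aY does not
-- depend on a; and δ_Y(H) = 1 if a ∈ H ∌ a' and Y is nonempty and disjoint from H. By
-- laminarity a cluster H with a ∈ H ∌ a' is J, lies strictly below J, or strictly above J.
-- Conditions 1–4 give δ_X(J) = 1, δ_X'(J) = 0, and δ_X(H) = δ_X'(H) for every other cluster: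
-- both X and X' straddle H when a' ∈ H or J ⊊ H, and both are disjoint from H when H ⊊ J.
module Submission where

open import Defs
open import Data.Nat using (ℕ; _≤_; _∸_; _+_; suc; s≤s)
open import Data.Fin using (Fin)
open import Data.Fin.Subset using (Subset; _∈_; _∉_; _⊆_; _⊂_; _⊃_; _∩_; _∪_; ⁅_⁆; ∣_∣; ⊥; Nonempty; Empty)
open import Data.Fin.Subset.Properties
  using (_∈?_; _⊆?_; _⊂?_; ⊆-antisym; ⊂-trans; ∉⊥; x∈⁅x⁆; x∈⁅y⁆⇒x≡y; x∈p∪q⁺; x∈p∪q⁻;
         x∈p∩q⁺; x∈p∩q⁻; p∩q⊆p; p∩q⊆q; ∩-comm; nonempty?; Empty-unique; ∣⊥∣≡0)
open import Data.Fin.Subset.Induction using (Acc; acc; ⊂-wellFounded; ⊃-wellFounded)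
open import Data.Fin.Properties using (¬∀⟶∃¬)
open import Data.Integer as Int using (ℤ; _-_; 0ℤ; 1ℤ)
open import Data.Integer.Properties using (+-inverseʳ)
open import Data.Integer.Tactic.RingSolver using (solve-∀)
open import Data.List using (List; []; _∷_; filter)
open import Data.List.Membership.Propositional using (find; lose) renaming (_∈_ to _∈ˡ_; _∉_ to _∉ˡ_)
open import Data.List.Membership.Propositional.Properties using (∈-filter⁺; ∈-filter⁻)
open import Data.List.Relation.Unary.Any using (here; there; any?)
open import Data.List.Relation.Unary.All as All using ()
open import Data.List.Relation.Unary.AllPairs using (_∷_)
open import Data.List.Relation.Unary.Unique.Propositional using (Unique)
open import Data.List.Relation.Unary.Unique.Propositional.Properties using (filter⁺)
open import Data.Product using (_×_; _,_; proj₁; proj₂; ∃-syntax)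
open import Data.Sum using (_⊎_; inj₁; inj₂; [_,_]; map₁)
open import Function using (_∘_; flip; const)
open import Function.Bundles using (_⇔_; mk⇔; Equivalence)
open import Function.Properties.Equivalence using () renaming (sym to ⇔-sym; trans to ⇔-trans)
open import Induction.WellFounded using (WellFounded)
open import Level using (0ℓ)
open import Relation.Binary.Definitions using (Transitive) renaming (Decidable to Decidable₂)
open import Relation.Binary.PropositionalEquality using (_≡_; _≢_; refl; sym; trans; cong; cong₂; subst)
open import Relation.Nullary using (¬_; Dec; yes; no; contradiction)
open import Relation.Nullary.Decidable using (_×-dec_; _→-dec_; decidable-stable)
open import Relation.Unary using (Pred) renaming (Decidable to Decidable₁)

private variable n : ℕ

⟦_⟧ : {A : Set} → Dec A → ℤ
⟦ yes _ ⟧ = 1ℤ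
⟦ no _ ⟧  = 0ℤ

⟦⟧-yes : {A : Set} → A → (d : Dec A) → ⟦ d ⟧ ≡ 1ℤ
⟦⟧-yes a (yes _) = refl
⟦⟧-yes a (no ¬a) = contradiction a ¬a

⟦⟧-no : {A : Set} → ¬ A → (d : Dec A) → ⟦ d ⟧ ≡ 0ℤ
⟦⟧-no ¬a (yes a) = contradiction a ¬a
⟦⟧-no ¬a (no _)  = refl

⟦⟧-cong : {A B : Set} → A ⇔ B → (d : Dec A) (e : Dec B) → ⟦ d ⟧ ≡ ⟦ e ⟧
⟦⟧-cong A⇔B d (yes b) = ⟦⟧-yes (Equivalence.from A⇔B b) d
⟦⟧-cong A⇔B d (no ¬b) = ⟦⟧-no (¬b ∘ Equivalence.to A⇔B) d

module _ {A : Set} {_<_ : A → A → Set} (_<?_ : Decidable₂ _<_) (<-trans : Transitive _<_)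
         (wf : WellFounded (flip _<_)) {P : Pred A 0ℓ} (P? : Decidable₁ P) (L : List A) where

  IsMaximal : A → Set
  IsMaximal M = M ∈ˡ L × P M × (∀ y → y ∈ˡ L → P y → ¬ (M < y))

  maximal-above : ∀ {x} → x ∈ˡ L → P x → ∃[ M ] (IsMaximal M × (x ≡ M ⊎ x < M))
  maximal-above = go (wf _)
    where
    go : ∀ {x} → Acc (flip _<_) x → x ∈ˡ L → P x → ∃[ M ] (IsMaximal M × (x ≡ M ⊎ x < M))
    go {x} (acc rs) x∈L Px with any? (λ y → P? y ×-dec x <? y) L
    ... | no none = x , (x∈L , Px , λ y y∈L Py x<y → none (lose y∈L (Py , x<y))) , inj₁ refl
    ... | yes some with find some
    ...   | y , y∈L , Py , x<y with go (rs x<y) y∈L Py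
    ...     | M , M-max , y≤M = M , M-max , inj₂ ([ (λ { refl → x<y }) , <-trans x<y ] y≤M)

_⊃?_ : Decidable₂ (_⊃_ {n})
p ⊃? q = q ⊂? p

⊃-trans : Transitive (_⊃_ {n})
⊃-trans p⊃q q⊃r = ⊂-trans q⊃r p⊃q

≡⊎⊂⇒⊆ : {p q : Subset n} → p ≡ q ⊎ p ⊂ q → p ⊆ q
≡⊎⊂⇒⊆ (inj₁ refl) = λ x∈p → x∈p
≡⊎⊂⇒⊆ (inj₂ p⊂q)  = proj₁ p⊂q

⊆∧≢⇒⊂ : {p q : Subset n} → p ⊆ q → p ≢ q → p ⊂ q
⊆∧≢⇒⊂ {n} {p} {q} p⊆q p≢q
  with ¬∀⟶∃¬ n (λ x → x ∈ q → x ∈ p) (λ x → x ∈? q →-dec x ∈? p)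
               (λ q⊆p → p≢q (⊆-antisym p⊆q (q⊆p _)))
... | x , x∈q↛x∈p =
  p⊆q , x , decidable-stable (x ∈? q) (λ x∉q → x∈q↛x∈p (λ x∈q → contradiction x∈q x∉q))
  , x∈q↛x∈p ∘ const

∩≡⊥⇒∉ : {p q : Subset n} {x : Fin n} → p ∩ q ≡ ⊥ → x ∈ p → x ∉ q
∩≡⊥⇒∉ p∩q≡⊥ x∈p x∈q = ∉⊥ (subst (_ ∈_) p∩q≡⊥ (x∈p∩q⁺ (x∈p , x∈q)))

∩≡⊥⇒Empty : {p q r : Subset n} → p ∩ q ≡ ⊥ → r ⊆ q → Empty (r ∩ p)
∩≡⊥⇒Empty {r = r} p∩q≡⊥ r⊆q (x , x∈r∩p) with x∈p∩q⁻ r _ x∈r∩p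
... | x∈r , x∈p = ∩≡⊥⇒∉ p∩q≡⊥ x∈p (r⊆q x∈r)

Nonempty-∩-monoˡ : {p q r : Subset n} → p ⊆ q → Nonempty (p ∩ r) → Nonempty (q ∩ r)
Nonempty-∩-monoˡ {p = p} {r = r} p⊆q (x , x∈p∩r) with x∈p∩q⁻ p r x∈p∩r
... | x∈p , x∈r = x , x∈p∩q⁺ (p⊆q x∈p , x∈r)

Nonempty-∩-monoʳ : {p q r : Subset n} → q ⊆ r → Nonempty (p ∩ q) → Nonempty (p ∩ r)
Nonempty-∩-monoʳ {p = p} {q} q⊆r (x , x∈p∩q) with x∈p∩q⁻ p q x∈p∩q
... | x∈p , x∈q = x , x∈p∩q⁺ (x∈p , q⊆r x∈q)

nonempty-of-size : {p : Subset n} {m : ℕ} → ∣ p ∣ ≡ suc m → Nonempty p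
nonempty-of-size {n} {p} ∣p∣≡1+m with nonempty? p
... | yes ne = ne
... | no ¬ne with trans (sym ∣p∣≡1+m) (trans (cong ∣_∣ (Empty-unique ¬ne)) (∣⊥∣≡0 n))
...   | ()

gen-self : (H : Subset n) → gen H H ≡ 1ℤ
gen-self H with H ≟ˢ H
... | yes _   = refl
... | no H≢H = contradiction refl H≢H

gen-≢ : {H K : Subset n} → K ≢ H → gen H K ≡ 0ℤ
gen-≢ {H = H} {K} K≢H with K ≟ˢ H
... | yes K≡H = contradiction K≡H K≢H
... | no _    = refl

Σᶜ-∉ : {L : List (Subset n)} {H : Subset n} → H ∉ˡ L → Σᶜ L H ≡ 0ℤ
Σᶜ-∉ {L = []}    H∉L = refl
Σᶜ-∉ {L = G ∷ L} {H} H∉L =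
  cong₂ Int._+_ (gen-≢ {H = G} {H} (H∉L ∘ here)) (Σᶜ-∉ {L = L} (H∉L ∘ there))

Σᶜ-∈ : {L : List (Subset n)} {H : Subset n} → Unique L → H ∈ˡ L → Σᶜ L H ≡ 1ℤ
Σᶜ-∈ {L = H ∷ L} (H∉L ∷ _) (here refl) =
  cong₂ Int._+_ (gen-self H) (Σᶜ-∉ {L = L} (λ H∈L → All.lookup H∉L H∈L refl))
Σᶜ-∈ {L = G ∷ L} {H} (G∉L ∷ L-unique) (there H∈L) =
  cong₂ Int._+_ (gen-≢ {H = G} {H} (λ { refl → All.lookup G∉L H∈L refl })) (Σᶜ-∈ L-unique H∈L)

Σᶜ-filter : {L : List (Subset n)} {H : Subset n} {P : Pred (Subset n) 0ℓ} (P? : Decidable₁ P) →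
            Unique L → H ∈ˡ L → Σᶜ (filter P? L) H ≡ ⟦ P? H ⟧
Σᶜ-filter {L = L} {H} P? L-unique H∈L with P? H
... | yes PH = Σᶜ-∈ {L = filter P? L} (filter⁺ P? L-unique) (∈-filter⁺ P? H∈L PH)
... | no ¬PH = Σᶜ-∉ {L = filter P? L} (¬PH ∘ proj₂ ∘ ∈-filter⁻ P? {xs = L})

module _ {a : Fin n} {Y : Subset n} where

  ∈-insert-self : a ∈ ⁅ a ⁆ ∪ Y
  ∈-insert-self = x∈p∪q⁺ (inj₁ (x∈⁅x⁆ a))

  ∈-insert⁺ : {y : Fin n} → y ∈ Y → y ∈ ⁅ a ⁆ ∪ Y
  ∈-insert⁺ y∈Y = x∈p∪q⁺ (inj₂ y∈Y)

  ∈-insert⁻ : {y : Fin n} → y ∈ ⁅ a ⁆ ∪ Y → y ≡ a ⊎ y ∈ Y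
  ∈-insert⁻ y∈aY = map₁ (x∈⁅y⁆⇒x≡y a) (x∈p∪q⁻ ⁅ a ⁆ Y y∈aY)

  crosses-insert-∈ : {H : Subset n} → a ∈ H → Crosses (⁅ a ⁆ ∪ Y) H ⇔ (¬ Y ⊆ H)
  crosses-insert-∈ {H} a∈H = mk⇔
    (λ (_ , aY⊈H) Y⊆H →
       aY⊈H λ {_} y∈aY → [ (λ { refl → a∈H }) , (λ y∈Y → Y⊆H y∈Y) ] (∈-insert⁻ y∈aY))
    (λ Y⊈H →
       (a , x∈p∩q⁺ (a∈H , ∈-insert-self)) , λ aY⊆H → Y⊈H λ {_} y∈Y → aY⊆H (∈-insert⁺ y∈Y))

  crosses-insert-∉ : {H : Subset n} → a ∉ H → Crosses (⁅ a ⁆ ∪ Y) H ⇔ Nonempty (H ∩ Y)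
  crosses-insert-∉ {H} a∉H = mk⇔
    (λ ((y , y∈H∩aY) , _) → meet y (x∈p∩q⁻ H _ y∈H∩aY))
    (λ H∩Y≢∅ → Nonempty-∩-monoʳ ∈-insert⁺ H∩Y≢∅ , λ aY⊆H → a∉H (aY⊆H ∈-insert-self))
    where
    meet : ∀ y → y ∈ H × y ∈ ⁅ a ⁆ ∪ Y → Nonempty (H ∩ Y)
    meet y (y∈H , y∈aY) =
      [ (λ { refl → contradiction y∈H a∉H }) , (λ y∈Y → y , x∈p∩q⁺ (y∈H , y∈Y)) ] (∈-insert⁻ y∈aY)

  crosses-straddling : {H : Subset n} → Nonempty (H ∩ Y) → ¬ Y ⊆ H → Crosses (⁅ a ⁆ ∪ Y) H
  crosses-straddling {H} H∩Y≢∅ Y⊈H with a ∈? H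
  ... | yes a∈H = Equivalence.from (crosses-insert-∈ a∈H) Y⊈H
  ... | no a∉H  = Equivalence.from (crosses-insert-∉ a∉H) H∩Y≢∅

crossCoeff : Subset n → Subset n → ℤ
crossCoeff S H = ⟦ crosses? S H ⟧

swapDefect : Fin n → Fin n → Subset n → Subset n → ℤ
swapDefect a a' Y H = crossCoeff (⁅ a ⁆ ∪ Y) H - crossCoeff (⁅ a' ⁆ ∪ Y) H

module _ {a a' : Fin n} {Y H : Subset n} where

  swapDefect-unseparated : (a ∈ H ⇔ a' ∈ H) → swapDefect a a' Y H ≡ 0ℤ
  swapDefect-unseparated a⇔a' =
    trans (cong (_- _) (⟦⟧-cong same-crossing (crosses? _ H) (crosses? _ H)))
          (+-inverseʳ (crossCoeff (⁅ a' ⁆ ∪ Y) H))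
    where
    same-crossing : Crosses (⁅ a ⁆ ∪ Y) H ⇔ Crosses (⁅ a' ⁆ ∪ Y) H
    same-crossing with a ∈? H
    ... | yes a∈H = ⇔-trans (crosses-insert-∈ a∈H)
                            (⇔-sym (crosses-insert-∈ (Equivalence.to a⇔a' a∈H)))
    ... | no a∉H  = ⇔-trans (crosses-insert-∉ a∉H)
                            (⇔-sym (crosses-insert-∉ (a∉H ∘ Equivalence.from a⇔a')))

  swapDefect-straddling : Nonempty (H ∩ Y) → ¬ Y ⊆ H → swapDefect a a' Y H ≡ 0ℤ
  swapDefect-straddling H∩Y≢∅ Y⊈H =
    cong₂ _-_ (⟦⟧-yes (crosses-straddling H∩Y≢∅ Y⊈H) (crosses? _ H))
              (⟦⟧-yes (crosses-straddling H∩Y≢∅ Y⊈H) (crosses? _ H))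

  swapDefect-disjoint : a ∈ H → a' ∉ H → Nonempty Y → Empty (H ∩ Y) → swapDefect a a' Y H ≡ 1ℤ
  swapDefect-disjoint a∈H a'∉H (y , y∈Y) H∩Y≡∅ =
    cong₂ _-_ (⟦⟧-yes (Equivalence.from (crosses-insert-∈ a∈H) Y⊈H) (crosses? _ H))
              (⟦⟧-no (H∩Y≡∅ ∘ Equivalence.to (crosses-insert-∉ a'∉H)) (crosses? _ H))
    where
    Y⊈H : ¬ Y ⊆ H
    Y⊈H Y⊆H = H∩Y≡∅ (y , x∈p∩q⁺ (Y⊆H y∈Y , y∈Y))

alternatingCrossSum : List (Subset n) → Fin n → Fin n → Subset n → Subset n → Comb n
alternatingCrossSum ℋ a a' X X' =
  crossSum ℋ (⁅ a ⁆ ∪ X) -ᶜ crossSum ℋ (⁅ a' ⁆ ∪ X)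
    -ᶜ crossSum ℋ (⁅ a ⁆ ∪ X') +ᶜ crossSum ℋ (⁅ a' ⁆ ∪ X')

module _ {ℋ : List (Subset n)} {a a' : Fin n} {X X' H : Subset n} where

  alternatingCrossSum-∈ : Unique ℋ → H ∈ℋ ℋ →
    alternatingCrossSum ℋ a a' X X' H ≡ swapDefect a a' X H - swapDefect a a' X' H
  alternatingCrossSum-∈ ℋ-unique H∈ℋ =
    trans (cong₂ Int._+_ (cong₂ _-_ (cong₂ _-_ (coeff (⁅ a ⁆ ∪ X)) (coeff (⁅ a' ⁆ ∪ X)))
                                    (coeff (⁅ a ⁆ ∪ X')))
                         (coeff (⁅ a' ⁆ ∪ X')))
          (regroup (crossCoeff (⁅ a ⁆ ∪ X) H) (crossCoeff (⁅ a' ⁆ ∪ X) H)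
                   (crossCoeff (⁅ a ⁆ ∪ X') H) (crossCoeff (⁅ a' ⁆ ∪ X') H))
    where
    coeff : ∀ S → crossSum ℋ S H ≡ crossCoeff S H
    coeff S = Σᶜ-filter (crosses? S) ℋ-unique H∈ℋ
    regroup : ∀ s t u v → s - t - u Int.+ v ≡ (s - t) - (u - v)
    regroup = solve-∀

  alternatingCrossSum-∉ : ¬ H ∈ℋ ℋ → alternatingCrossSum ℋ a a' X X' H ≡ 0ℤ
  alternatingCrossSum-∉ H∉ℋ =
    cong₂ Int._+_ (cong₂ _-_ (cong₂ _-_ (absent (⁅ a ⁆ ∪ X)) (absent (⁅ a' ⁆ ∪ X)))
                             (absent (⁅ a ⁆ ∪ X')))
                  (absent (⁅ a' ⁆ ∪ X'))
    where
    absent : ∀ S → crossSum ℋ S H ≡ 0ℤ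
    absent S = Σᶜ-∉ (H∉ℋ ∘ proj₁ ∘ ∈-filter⁻ (crosses? S))

module _ {ℋ : List (Subset n)} where

  extremalClustersContaining : {x : Fin n} {H : Subset n} → H ∈ℋ ℋ → x ∈ H →
    ∃[ m ] ∃[ M ] (IsMinClusterContaining ℋ x m × IsMaxClusterContaining ℋ x M × m ⊆ H × H ⊆ M)
  extremalClustersContaining {x} H∈ℋ x∈H
    with maximal-above _⊃?_ ⊃-trans ⊂-wellFounded (x ∈?_) ℋ H∈ℋ x∈H
       | maximal-above _⊂?_ ⊂-trans ⊃-wellFounded (x ∈?_) ℋ H∈ℋ x∈H
  ... | m , m-min , H≥m | M , M-max , H≤M =
    m , M , m-min , M-max , ≡⊎⊂⇒⊆ (map₁ sym H≥m) , ≡⊎⊂⇒⊆ H≤M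

  maxClusterAbove : {J H : Subset n} → H ∈ℋ ℋ → J ⊆ H → ∃[ K ] (IsMaxClusterAbove ℋ J K × H ⊆ K)
  maxClusterAbove {J} H∈ℋ J⊆H with maximal-above _⊂?_ ⊂-trans ⊃-wellFounded (J ⊆?_) ℋ H∈ℋ J⊆H
  ... | K , K-max , H≤K = K , K-max , ≡⊎⊂⇒⊆ H≤K

  maxClusterBelow : {a : Fin n} {J H : Subset n} → H ∈ℋ ℋ → a ∈ H → H ⊂ J →
                    ∃[ J̄ ] (IsMaxClusterBelow ℋ a J J̄ × H ⊆ J̄)
  maxClusterBelow {a} {J} H∈ℋ a∈H H⊂J
    with maximal-above _⊂?_ ⊂-trans ⊃-wellFounded (λ G → a ∈? G ×-dec G ⊂? J) ℋ H∈ℋ (a∈H , H⊂J)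
  ... | J̄ , (J̄∈ℋ , (a∈J̄ , J̄⊂J) , J̄-max) , H≤J̄ =
    J̄ , (J̄∈ℋ , a∈J̄ , J̄⊂J , λ G G∈ℋ a∈G G⊂J → J̄-max G G∈ℋ (a∈G , G⊂J)) , ≡⊎⊂⇒⊆ H≤J̄

  minClusterStrictlyAbove : {J H : Subset n} → H ∈ℋ ℋ → J ⊂ H →
                            ∃[ J̃ ] (IsMinClusterStrictlyAbove ℋ J J̃ × J̃ ⊆ H)
  minClusterStrictlyAbove {J} H∈ℋ J⊂H
    with maximal-above _⊃?_ ⊃-trans ⊂-wellFounded (J ⊂?_) ℋ H∈ℋ J⊂H
  ... | J̃ , J̃-min , H≥J̃ = J̃ , J̃-min , ≡⊎⊂⇒⊆ (map₁ sym H≥J̃)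

  nested-or-disjoint : IsHierarchy ℋ → {H H' : Subset n} → H ∈ℋ ℋ → H' ∈ℋ ℋ →
                       H ∩ H' ≡ ⊥ ⊎ H ⊆ H' ⊎ H' ⊆ H
  nested-or-disjoint hier {H} {H'} H∈ℋ H'∈ℋ with IsHierarchy.laminar hier H∈ℋ H'∈ℋ
  ... | inj₁ H∩H'≡⊥         = inj₁ H∩H'≡⊥
  ... | inj₂ (inj₁ H∩H'≡H)  = inj₂ (inj₁ λ x∈H → p∩q⊆q H H' (subst (_ ∈_) (sym H∩H'≡H) x∈H))
  ... | inj₂ (inj₂ H∩H'≡H') = inj₂ (inj₂ λ x∈H' → p∩q⊆p H H' (subst (_ ∈_) (sym H∩H'≡H') x∈H'))

Condition₁ : List (Subset n) → Fin n → Subset n → Subset n → Set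
Condition₁ ℋ a' X X' =
  ∀ M m → IsMaxClusterContaining ℋ a' M → IsMinClusterContaining ℋ a' m →
    (∃[ b ] (b ∈ m × ¬ (b ≡ a') × b ∈ X × b ∈ X'))
    × (∃[ c ] (c ∈ X × c ∉ M))
    × (∃[ c' ] (c' ∈ X' × c' ∉ M))

Condition₂ : List (Subset n) → Fin n → Subset n → Subset n → Subset n → Set
Condition₂ ℋ a' J X X' =
  (∀ H → H ∈ℋ ℋ → a' ∉ H) → ∀ K → IsMaxClusterAbove ℋ J K → ∃[ d ] (d ∈ X × d ∈ X' × d ∉ K)

Condition₃ : List (Subset n) → Fin n → Subset n → Subset n → Set
Condition₃ ℋ a J X' =
  (∀ J̄ → IsMaxClusterBelow ℋ a J J̄ → (∃[ x ] (x ∈ X' × x ∈ J × x ∉ J̄)) × (X' ∩ J̄ ≡ ⊥))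
  × ((∀ H → H ∈ℋ ℋ → a ∈ H → ¬ (H ⊂ J)) → Nonempty (X' ∩ J))

Condition₄ : List (Subset n) → Subset n → Subset n → Set
Condition₄ ℋ J X =
  X ∩ J ≡ ⊥ × (∀ J̃ → IsMinClusterStrictlyAbove ℋ J J̃ → ∃[ x ] (x ∈ X × x ∈ J̃ × x ∉ J))

module Coefficients {ℋ : List (Subset n)} (hier : IsHierarchy ℋ)
    {a a' : Fin n} {J X X' : Subset n} (J∈ℋ : J ∈ℋ ℋ) (a∈J : a ∈ J) (a'∉J : a' ∉ J)
    (X≢∅ : Nonempty X)
    (cond₁ : Condition₁ ℋ a' X X') (cond₂ : Condition₂ ℋ a' J X X')
    (cond₃ : Condition₃ ℋ a J X') (cond₄ : Condition₄ ℋ J X) where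

  δ : Subset n → Subset n → ℤ
  δ = swapDefect a a'

  X-disjoint : {H : Subset n} → H ⊆ J → Empty (H ∩ X)
  X-disjoint = ∩≡⊥⇒Empty (proj₁ cond₄)

  leave-above-J : {H : Subset n} → H ∈ℋ ℋ → a' ∉ H → J ⊆ H → ¬ X ⊆ H × ¬ X' ⊆ H
  leave-above-J {H} H∈ℋ a'∉H J⊆H with any? (a' ∈?_) ℋ
  ... | yes a'∈some with find a'∈some
  ...   | G , G∈ℋ , a'∈G with extremalClustersContaining G∈ℋ a'∈G
  ...     | m , M , m-min , M-max , m⊆G , G⊆M
          with cond₁ M m M-max m-min | nested-or-disjoint hier H∈ℋ (proj₁ M-max)
  ... | (b , b∈m , _ , b∈X , b∈X') , _ | inj₁ H∩M≡⊥ =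
    (λ X⊆H → ∩≡⊥⇒∉ H∩M≡⊥ (X⊆H b∈X) (G⊆M (m⊆G b∈m)))
    , (λ X'⊆H → ∩≡⊥⇒∉ H∩M≡⊥ (X'⊆H b∈X') (G⊆M (m⊆G b∈m)))
  ... | _ , (c , c∈X , c∉M) , (c' , c'∈X' , c'∉M) | inj₂ (inj₁ H⊆M) =
    (λ X⊆H → c∉M (H⊆M (X⊆H c∈X))) , (λ X'⊆H → c'∉M (H⊆M (X'⊆H c'∈X')))
  ... | _ | inj₂ (inj₂ M⊆H) = contradiction (M⊆H (proj₁ (proj₂ M-max))) a'∉H
  leave-above-J {H} H∈ℋ a'∉H J⊆H | no a'∈none with maxClusterAbove H∈ℋ J⊆H
  ... | K , K-max , H⊆K with cond₂ (λ G G∈ℋ a'∈G → a'∈none (lose G∈ℋ a'∈G)) K K-max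
  ...   | d , d∈X , d∈X' , d∉K =
    (λ X⊆H → d∉K (H⊆K (X⊆H d∈X))) , (λ X'⊆H → d∉K (H⊆K (X'⊆H d∈X')))

  X'-meets-J : Nonempty (J ∩ X')
  X'-meets-J with any? (λ G → a ∈? G ×-dec G ⊂? J) ℋ
  ... | yes below with find below
  ...   | G , G∈ℋ , a∈G , G⊂J with maxClusterBelow G∈ℋ a∈G G⊂J
  ...     | J̄ , J̄-max , _ with proj₁ (proj₁ cond₃ J̄ J̄-max)
  ...       | x , x∈X' , x∈J , _ = x , x∈p∩q⁺ (x∈J , x∈X')
  X'-meets-J | no none =
    subst Nonempty (∩-comm X' J) (proj₂ cond₃ λ H H∈ℋ a∈H H⊂J → none (lose H∈ℋ (a∈H , H⊂J)))

  δ-at-J : δ X J - δ X' J ≡ 1ℤ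
  δ-at-J = cong₂ _-_ (swapDefect-disjoint a∈J a'∉J X≢∅ (X-disjoint λ x∈J → x∈J))
                     (swapDefect-straddling X'-meets-J (proj₂ (leave-above-J J∈ℋ a'∉J λ x∈J → x∈J)))

  δ-unseparated : {H : Subset n} → a ∈ H ⇔ a' ∈ H → δ X H ≡ δ X' H
  δ-unseparated a⇔a' = trans (swapDefect-unseparated a⇔a') (sym (swapDefect-unseparated a⇔a'))

  δ-around-a' : {H : Subset n} → H ∈ℋ ℋ → a ∉ H → a' ∈ H → δ X H ≡ δ X' H
  δ-around-a' H∈ℋ a∉H a'∈H with extremalClustersContaining H∈ℋ a'∈H
  ... | m , M , m-min , M-max , m⊆H , H⊆M with cond₁ M m M-max m-min
  ...   | (b , b∈m , _ , b∈X , b∈X') , (c , c∈X , c∉M) , (c' , c'∈X' , c'∉M) =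
    trans (swapDefect-straddling (b , x∈p∩q⁺ (m⊆H b∈m , b∈X)) λ X⊆H → c∉M (H⊆M (X⊆H c∈X)))
          (sym (swapDefect-straddling (b , x∈p∩q⁺ (m⊆H b∈m , b∈X'))
                                      λ X'⊆H → c'∉M (H⊆M (X'⊆H c'∈X'))))

  δ-below-J : {H : Subset n} → H ∈ℋ ℋ → a ∈ H → H ⊂ J → δ X H ≡ δ X' H
  δ-below-J {H} H∈ℋ a∈H H⊂J with maxClusterBelow H∈ℋ a∈H H⊂J
  ... | J̄ , J̄-max , H⊆J̄ with proj₁ cond₃ J̄ J̄-max
  ...   | (x , x∈X' , _) , X'∩J̄≡⊥ =
    trans (swapDefect-disjoint a∈H a'∉H X≢∅ (X-disjoint (proj₁ H⊂J)))
          (sym (swapDefect-disjoint a∈H a'∉H (x , x∈X') (∩≡⊥⇒Empty X'∩J̄≡⊥ H⊆J̄)))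
    where
    a'∉H : a' ∉ H
    a'∉H = a'∉J ∘ proj₁ H⊂J

  δ-above-J : {H : Subset n} → H ∈ℋ ℋ → a' ∉ H → J ⊂ H → δ X H ≡ δ X' H
  δ-above-J H∈ℋ a'∉H J⊂H with minClusterStrictlyAbove H∈ℋ J⊂H | leave-above-J H∈ℋ a'∉H (proj₁ J⊂H)
  ... | J̃ , J̃-min , J̃⊆H | X⊈H , X'⊈H with proj₂ cond₄ J̃ J̃-min
  ...   | x , x∈X , x∈J̃ , _ =
    trans (swapDefect-straddling (x , x∈p∩q⁺ (J̃⊆H x∈J̃ , x∈X)) X⊈H)
          (sym (swapDefect-straddling (Nonempty-∩-monoˡ (proj₁ J⊂H) X'-meets-J) X'⊈H))

  δ-away-from-J : {H : Subset n} → H ∈ℋ ℋ → H ≢ J → δ X H ≡ δ X' H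
  δ-away-from-J {H} H∈ℋ H≢J with a ∈? H | a' ∈? H
  ... | yes a∈H | yes a'∈H = δ-unseparated (mk⇔ (const a'∈H) (const a∈H))
  ... | no a∉H  | no a'∉H  =
    δ-unseparated (mk⇔ (λ a∈H → contradiction a∈H a∉H) (λ a'∈H → contradiction a'∈H a'∉H))
  ... | no a∉H  | yes a'∈H = δ-around-a' H∈ℋ a∉H a'∈H
  ... | yes a∈H | no a'∉H with nested-or-disjoint hier H∈ℋ J∈ℋ
  ...   | inj₁ H∩J≡⊥        = contradiction a∈J (∩≡⊥⇒∉ H∩J≡⊥ a∈H)
  ...   | inj₂ (inj₁ H⊆J)  = δ-below-J H∈ℋ a∈H (⊆∧≢⇒⊂ H⊆J H≢J)
  ...   | inj₂ (inj₂ J⊆H)  = δ-above-J H∈ℋ a'∉H (⊆∧≢⇒⊂ J⊆H (H≢J ∘ sym))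

  gen-coefficient : {H : Subset n} → H ∈ℋ ℋ → gen J H ≡ δ X H - δ X' H
  gen-coefficient {H} H∈ℋ = by-cases (H ≟ˢ J)
    where
    by-cases : Dec (H ≡ J) → gen J H ≡ δ X H - δ X' H
    by-cases (yes H≡J) =
      subst (λ G → gen J G ≡ δ X G - δ X' G) (sym H≡J) (trans (gen-self J) (sym δ-at-J))
    by-cases (no H≢J) =
      trans (gen-≢ H≢J) (sym (trans (cong (_- δ X' H) (δ-away-from-J H∈ℋ H≢J)) (+-inverseʳ (δ X' H))))

lemma4p2 :
    (k n : ℕ) → 4 ≤ k → k + 2 ≤ n →
    (ℋ : List (Subset n)) → IsHierarchy ℋ →
    (∀ H → H ∈ℋ ℋ → 2 ≤ ∣ H ∣ × ∣ H ∣ ≤ n ∸ k) →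
    (a a' : Fin n) (J : Subset n) → J ∈ℋ ℋ → a ∈ J → a' ∉ J →
    (X X' : Subset n) →
    ∣ X ∣ ≡ k ∸ 1 → a ∉ X → a' ∉ X →
    ∣ X' ∣ ≡ k ∸ 1 → a ∉ X' → a' ∉ X' →
    (∀ M m → IsMaxClusterContaining ℋ a' M → IsMinClusterContaining ℋ a' m →
      (∃[ b ] (b ∈ m × ¬ (b ≡ a') × b ∈ X × b ∈ X'))
      × (∃[ c ] (c ∈ X × c ∉ M))
      × (∃[ c' ] (c' ∈ X' × c' ∉ M))) →
    ((∀ H → H ∈ℋ ℋ → a' ∉ H) →
      ∀ K → IsMaxClusterAbove ℋ J K →
      ∃[ d ] (d ∈ X × d ∈ X' × d ∉ K)) →
    (∀ J̄ → IsMaxClusterBelow ℋ a J J̄ →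
      (∃[ x ] (x ∈ X' × x ∈ J × x ∉ J̄)) × (X' ∩ J̄ ≡ ⊥)) →
    ((∀ H → H ∈ℋ ℋ → a ∈ H → ¬ (H ⊂ J)) → Nonempty (X' ∩ J)) →
    X ∩ J ≡ ⊥ →
    (∀ J̃ → IsMinClusterStrictlyAbove ℋ J J̃ →
      ∃[ x ] (x ∈ X × x ∈ J̃ × x ∉ J)) →
    gen J ≈ᶜ
      crossSum ℋ (⁅ a ⁆ ∪ X) -ᶜ crossSum ℋ (⁅ a' ⁆ ∪ X)
        -ᶜ crossSum ℋ (⁅ a ⁆ ∪ X') +ᶜ crossSum ℋ (⁅ a' ⁆ ∪ X')
lemma4p2 (suc k) n (s≤s (s≤s _)) _ ℋ hier _ a a' J J∈ℋ a∈J a'∉J X X' ∣X∣≡k _ _ _ _ _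
         cond₁ cond₂ cond₃ cond₃′ cond₄ cond₄′ H
  with any? (H ≟ˢ_) ℋ
... | yes H∈ℋ = trans (gen-coefficient H∈ℋ) (sym (alternatingCrossSum-∈ (IsHierarchy.noDup hier) H∈ℋ))
  where
  open Coefficients hier J∈ℋ a∈J a'∉J (nonempty-of-size ∣X∣≡k)
                    cond₁ cond₂ (cond₃ , cond₃′) (cond₄ , cond₄′)
... | no H∉ℋ  = trans (gen-≢ λ { refl → H∉ℋ J∈ℋ }) (sym (alternatingCrossSum-∉ H∉ℋ))
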